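{- For each positive integer $i$, let $\mathcal{F}_i$ be an edge-coloured digraph with $i$ vertices all of whose edges are double. For each composition $\alpha=(\alpha_1,\dots,\alpha_k)$ of $n$, let $\mathcal{F}_\alpha$ be the edge-coloured digraph obtained from the disjoint union of $\mathcal{F}_{\alpha_1},\dots,\mathcal{F}_{\alpha_k}$ by adding a solid edge $a\rightarrow b$ for every $a\in V(\mathcal{F}_{\alpha_p})$, $b\in V(\mathcal{F}_{\alpha_q})$ with $p<q$. Then $\{\mathscr{X}_{\mathcal{F}_\alpha}(x):\alpha\vDash n\}$ is a basis of $\mathrm{QSym}_n(x)$.
   Context: An edge-coloured digraph is a finite simple digraph (no loops; at most one edge from $a$ to $b$ for distinct $a,b$) whose edges are dashed ($\dashrightarrow$), solid ($\rightarrow$) or double ($\Rightarrow$). A proper vertex-colouring is $\kappa:V(G)\to\mathbb{P}$ with $\kappa(a)\ne\kappa(b)$ if $a\dashrightarrow b$, $\kappa(a)<\kappa(b)$ if $a\rightarrow b$, $\kappa(a)\le\kappa(b)$ if $a\Rightarrow b$; $\mathscr{X}_G(x)=\sum_\kappa\prod_{a\in V(G)}x_{\kappa(a)}$ over proper vertex-colourings (commuting variables). A composition of $n$ is a sequence of positive integers summing to $n$. $\mathrm{QSym}_n(x)$ is the space of quasisymmetric functions homogeneous of degree $n$ (formal power series in which, for every composition $(\beta_1,\dots,\beta_k)$, all monomials $x_{i_1}^{\beta_1}\cdots x_{i_k}^{\beta_k}$ with $i_1<\dots<i_k$ have equal coefficients). -}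

module Defs where

open import Data.Nat using (ℕ; zero; suc; _+_; _<_; _≤_; _≟_; _<?_; _≤?_)
open import Data.Fin using (Fin; splitAt; toℕ)
open import Data.Fin.Properties using (all?)
open import Data.Sum using (_⊎_; inj₁; inj₂)
open import Data.Maybe using (Maybe; just; nothing)
open import Data.Product using (Σ; _×_; _,_; proj₁; proj₂; ∃)
open import Data.Unit using (⊤; tt)
open import Data.Nat.ListAction using (sum)
open import Data.List using (List; []; _∷_; length; filter; map; allFin; concatMap; lookup; foldr)
open import Data.List.Properties using (≡-dec)
open import Data.List.Relation.Unary.All using (All)
open import Data.List.Relation.Unary.Unique.Propositional using (Unique)
open import Data.Vec as Vec using (Vec)
open import Data.Integer using (+_)
open import Data.Rational using (ℚ; _/_; 0ℚ) renaming (_+_ to _+ℚ_; _*_ to _*ℚ_)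
open import Relation.Nullary using (Dec; yes; no; ¬_)
open import Relation.Nullary.Decidable using (_×-dec_)
open import Relation.Binary.PropositionalEquality using (_≡_; _≢_; refl)

-- Edge-coloured digraphs on the vertex set Fin v.
-- edge a b = nothing : no edge from a to b; just t : an edge of type t.
-- (Simplicity: at most one edge a → b is automatic; loops are excluded.)

data EdgeType : Set where
  dashed solid double : EdgeType

record Digraph (v : ℕ) : Set where
  field
    edge     : Fin v → Fin v → Maybe EdgeType
    loopless : ∀ a → edge a a ≡ nothing
open Digraph public

AllEdgesDouble : ∀ {v} → Digraph v → Set
AllEdgesDouble {v} G = ∀ (a b : Fin v) → edge G a b ≡ nothing ⊎ edge G a b ≡ just double

joinEdge : ∀ {m k} → Digraph m → Digraph k → Fin (m + k) → Fin (m + k) → Maybe EdgeType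
joinEdge {m} G H a b with splitAt m a | splitAt m b
... | inj₁ a' | inj₁ b' = edge G a' b'
... | inj₁ _  | inj₂ _  = just solid
... | inj₂ _  | inj₁ _  = nothing
... | inj₂ a' | inj₂ b' = edge H a' b'

joinLoopless : ∀ {m k} (G : Digraph m) (H : Digraph k) (a : Fin (m + k)) → joinEdge G H a a ≡ nothing
joinLoopless {m} G H a with splitAt m a
... | inj₁ a' = loopless G a'
... | inj₂ a' = loopless H a'

join : ∀ {m k} → Digraph m → Digraph k → Digraph (m + k)
join G H = record { edge = joinEdge G H ; loopless = joinLoopless G H }

emptyDigraph : Digraph 0
emptyDigraph = record { edge = λ () ; loopless = λ () }

ordinalSum : ((i : ℕ) → Digraph i) → (α : List ℕ) → Digraph (sum α)
ordinalSum F []      = emptyDigraph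
ordinalSum F (a ∷ α) = join (F a) (ordinalSum F α)

IsComposition : ℕ → List ℕ → Set
IsComposition n α = All (λ a → 0 < a) α × sum α ≡ n

Composition : ℕ → Set
Composition n = Σ (List ℕ) (IsComposition n)

-- A monomial x₁^e₀ x₂^e₁ ⋯ x_m^e_{m-1} is encoded by its exponent list
-- (e₀ ∷ e₁ ∷ … ∷ e_{m-1} ∷ []); a series is its coefficient function.
-- (The lists e and e ++ [0] encode the same monomial; every series we
-- consider is invariant under this, see IsQSym below.)

Series : Set
Series = List ℕ → ℚ

-- exponent of the variable with index i (0-based) in e
expo : List ℕ → ℕ → ℕ
expo []       i       = 0
expo (x ∷ e)  zero    = x
expo (x ∷ e)  (suc i) = expo e i

-- deleting zeros from an exponent list gives the composition (β₁,…,β_k)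
-- of the monomial x_{i₁}^β₁ ⋯ x_{i_k}^β_k with i₁ < … < i_k
removeZeros : List ℕ → List ℕ
removeZeros []            = []
removeZeros (zero  ∷ e)   = removeZeros e
removeZeros (suc x ∷ e)   = suc x ∷ removeZeros e

IsQSym : ℕ → Series → Set
IsQSym n f =
  (∀ e → f e ≢ 0ℚ → sum e ≡ n) ×
  (∀ e e' → removeZeros e ≡ removeZeros e' → f e ≡ f e')

-- Chromatic quasisymmetric function 𝒳_G.
-- Colours: ℕ, colour c stands for the positive integer c+1 (variable x_{c+1}).

Compat : Maybe EdgeType → ℕ → ℕ → Set
Compat nothing       i j = ⊤
Compat (just dashed) i j = i ≢ j
Compat (just solid)  i j = i < j
Compat (just double) i j = i ≤ j

compat? : ∀ t i j → Dec (Compat t i j)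
compat? nothing       i j = yes tt
compat? (just dashed) i j with i ≟ j
... | yes p = no (λ q → q p)
... | no p  = yes p
compat? (just solid)  i j = i <? j
compat? (just double) i j = i ≤? j

IsProper : ∀ {v} → Digraph v → (Fin v → ℕ) → Set
IsProper {v} G κ = ∀ (a b : Fin v) → Compat (edge G a b) (κ a) (κ b)

isProper? : ∀ {v} (G : Digraph v) (κ : Fin v → ℕ) → Dec (IsProper G κ)
isProper? G κ = all? (λ a → all? (λ b → compat? (edge G a b) (κ a) (κ b)))

allMaps : (v m : ℕ) → List (Vec (Fin m) v)
allMaps zero    m = Vec.[] ∷ []
allMaps (suc v) m = concatMap (λ c → map (c Vec.∷_) (allMaps v m)) (allFin m)

colourCount : ∀ {v} → (Fin v → ℕ) → ℕ → ℕ
colourCount {v} κ c = length (filter (λ a → κ a ≟ c) (allFin v))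

content : ∀ {v} → ℕ → (Fin v → ℕ) → List ℕ
content {v} m κ = map (λ c → colourCount κ (toℕ c)) (allFin m)

-- coefficient of x^e in 𝒳_G: the number of proper colourings κ whose
-- colour-multiplicities are e. Such κ only use colours < length e, so
-- it suffices to enumerate κ : Fin v → Fin (length e).
chromCoeff : ∀ {v} → Digraph v → List ℕ → ℕ
chromCoeff {v} G e =
  length (filter (λ κv → isProper? G (κ κv) ×-dec ≡-dec _≟_ (content (length e) (κ κv)) e)
                 (allMaps v (length e)))
  where
  κ : Vec (Fin (length e)) v → Fin v → ℕ
  κ κv a = toℕ (Vec.lookup κv a)

𝒳 : ∀ {v} → Digraph v → Series
𝒳 G e = (+ chromCoeff G e) / 1

linComb : {I : Set} → (I → Series) → List (I × ℚ) → Series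
linComb b L e = foldr (λ p acc → (proj₂ p *ℚ b (proj₁ p) e) +ℚ acc) 0ℚ L

LinearlyIndependent : {I : Set} → (I → Series) → Set
LinearlyIndependent {I} b =
  ∀ (L : List (I × ℚ)) → Unique (map proj₁ L) →
    (∀ e → linComb b L e ≡ 0ℚ) → All (λ p → proj₂ p ≡ 0ℚ) L

IsBasisOfQSym : {I : Set} → ℕ → (I → Series) → Set
IsBasisOfQSym {I} n b =
  (∀ i → IsQSym n (b i)) ×
  LinearlyIndependent b ×
  (∀ f → IsQSym n f → ∃ λ (L : List (I × ℚ)) → ∀ e → linComb b L e ≡ f e)

-- For every digraph G, 𝒳_G lies in QSym_|V(G)|: the content of a colouring sums to |V(G)|,
-- and a colour used by no vertex can be squeezed out without affecting properness, which
-- makes coefficients invariant under deleting zero exponents.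
--
-- For F_α the solid edges between blocks make the colours increase from block to block, so a
-- proper colouring with at most ℓ(α) colours must give block p the colour p; the double edges
-- inside the blocks make that colouring proper. Hence the coefficient of x^β in 𝒳_{F_α} is 1
-- for β = α and 0 for every other β with ℓ(β) ≤ ℓ(α): ordered by length, the family is
-- unitriangular against the monomial quasisymmetric functions, hence a basis of QSym_n.

module Submission where

open import Defs
open import Data.Nat using (ℕ; zero; suc; _+_; _<_; _≤_; z≤n; s≤s; _≟_; _<?_)
open import Data.Nat.Properties
  using (suc-injective; ≤-refl; ≤-reflexive; ≤-trans; ≤-antisym; ≤-irrelevant; <⇒≤; <⇒≢; <⇒≱;
         ≰⇒>; ≮⇒≥; <-irrefl; m≤n⇒m<n∨m≡n; m≤m+n; m≤n+m; n≤1+n; +-mono-≤;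
         +-cancelʳ-≤; +-monoˡ-≤; ≤-pred; +-identityʳ; +-suc; m+1+n≢m; +-commutativeSemigroup;
         module ≤-Reasoning)
  renaming (≡-irrelevant to ℕ-≡-irrelevant)
open import Data.Nat.Induction using (<-rec)
open import Data.Nat.ListAction using (sum)
open import Algebra.Properties.CommutativeSemigroup +-commutativeSemigroup using (interchange)
open import Data.Fin as Fin using (Fin; toℕ; fromℕ<; punchIn; punchOut; splitAt; _↑ˡ_; _↑ʳ_)
import Data.Fin.Properties as Finₚ
open import Data.List
  using (List; []; _∷_; _++_; [_]; length; map; filter; tabulate; allFin; upTo; concatMap;
         cartesianProductWith)
open import Data.List.Properties
  using (≡-dec; filter-all; filter-none; filter-some; filter-++; filter-≐; filter-accept; filter-reject;
         length-++; length-map; length-tabulate; map-tabulate; map-cong; tabulate-cong; ++-assoc)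
open import Data.List.Membership.Propositional using (_∈_; lose)
open import Data.List.Membership.Propositional.Properties
  using (∈-filter⁺; ∈-filter⁻; ∈-map⁺; ∈-map⁻; ∈-allFin; ∈-upTo⁺; ∈-cartesianProductWith⁺)
open import Data.List.Membership.Propositional.Properties.WithK using (unique∧set⇒bag)
open import Data.List.Relation.Binary.BagAndSetEquality using (∼bag⇒↭)
open import Data.List.Relation.Binary.Permutation.Propositional.Properties using (↭-length)
open import Data.List.Relation.Unary.All as All using (All; []; _∷_)
open import Data.List.Relation.Unary.All.Properties using (all-filter)
open import Data.List.Relation.Unary.Any using (here; there)
open import Data.List.Relation.Unary.AllPairs using ([]; _∷_)
open import Data.List.Relation.Unary.Unique.Propositional using (Unique)
import Data.List.Relation.Unary.Unique.Propositional.Properties as Uniqueₚ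
open import Data.Vec as Vec using (Vec)
import Data.Vec.Properties as Vecₚ
open import Data.Empty using (⊥-elim)
open import Data.Maybe using (just; nothing)
open import Data.Product using (∃; _×_; _,_; proj₁; proj₂)
open import Data.Sum using (_⊎_; inj₁; inj₂; [_,_]′)
open import Data.Unit using (tt)
open import Data.Integer using () renaming (+_ to ℤ+_)
open import Data.Rational using (ℚ; _/_; 0ℚ; 1ℚ; _-_) renaming (_+_ to _+ℚ_; _*_ to _*ℚ_; _≟_ to _≟ℚ_)
import Data.Rational.Properties as ℚₚ
open import Data.Rational.Solver using (module +-*-Solver)
open import Function using (_∘_)
open import Function.Bundles using (_⇔_; mk⇔)
open import Relation.Binary.Definitions using (DecidableEquality)
open import Relation.Nullary using (Dec; yes; no; ¬_)
open import Relation.Nullary.Decidable using (_×-dec_; decidable-stable; map′)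
open import Relation.Binary.PropositionalEquality hiding ([_])

unique⇒length-≡ : ∀ {A : Set} {xs ys : List A} → Unique xs → Unique ys →
                  (∀ {z} → z ∈ xs ⇔ z ∈ ys) → length xs ≡ length ys
unique⇒length-≡ xs! ys! xs⇔ys = ↭-length (∼bag⇒↭ (unique∧set⇒bag xs! ys! xs⇔ys))

concatMap≡cartesianProductWith : ∀ {A B C : Set} (f : A → B → C) xs ys →
  concatMap (λ x → map (f x) ys) xs ≡ cartesianProductWith f xs ys
concatMap≡cartesianProductWith f []       ys = refl
concatMap≡cartesianProductWith f (x ∷ xs) ys =
  cong (map (f x) ys ++_) (concatMap≡cartesianProductWith f xs ys)

allMaps-unique : ∀ v m → Unique (allMaps v m)
allMaps-unique zero    m = [] ∷ []
allMaps-unique (suc v) m =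
  subst Unique (sym (concatMap≡cartesianProductWith Vec._∷_ (allFin m) (allMaps v m)))
    (Uniqueₚ.cartesianProductWith⁺ Vec._∷_ Vecₚ.∷-injective (Uniqueₚ.allFin⁺ m) (allMaps-unique v m))

∈-allMaps : ∀ {v m} (w : Vec (Fin m) v) → w ∈ allMaps v m
∈-allMaps {zero}      Vec.[]       = here refl
∈-allMaps {suc v} {m} (c Vec.∷ w) =
  subst (_ ∈_) (sym (concatMap≡cartesianProductWith Vec._∷_ (allFin m) (allMaps v m)))
    (∈-cartesianProductWith⁺ Vec._∷_ (∈-allFin c) (∈-allMaps w))

lookup-ext : ∀ {A : Set} {n} {xs ys : Vec A n} →
             (∀ i → Vec.lookup xs i ≡ Vec.lookup ys i) → xs ≡ ys
lookup-ext {xs = xs} {ys} eq =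
  trans (sym (Vecₚ.tabulate∘lookup xs)) (trans (Vecₚ.tabulate-cong eq) (Vecₚ.tabulate∘lookup ys))

countColour : ∀ {A : Set} → (A → ℕ) → ℕ → List A → ℕ
countColour κ c xs = length (filter (λ a → κ a ≟ c) xs)

module _ {A : Set} (κ : A → ℕ) (c : ℕ) where

  countColour-none : ∀ xs → (∀ a → κ a ≢ c) → countColour κ c xs ≡ 0
  countColour-none xs κ≢c = cong length (filter-none (λ a → κ a ≟ c) (All.universal κ≢c xs))

  countColour-all : ∀ xs → (∀ a → κ a ≡ c) → countColour κ c xs ≡ length xs
  countColour-all xs κ≡c = cong length (filter-all (λ a → κ a ≟ c) (All.universal κ≡c xs))

  countColour≡0⇒ : ∀ {xs a} → countColour κ c xs ≡ 0 → a ∈ xs → κ a ≢ c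
  countColour≡0⇒ none a∈xs κa≡c = <⇒≢ (filter-some (λ a → κ a ≟ c) (lose a∈xs κa≡c)) (sym none)

  countColour-++ : ∀ xs ys → countColour κ c (xs ++ ys) ≡ countColour κ c xs + countColour κ c ys
  countColour-++ xs ys =
    trans (cong length (filter-++ (λ a → κ a ≟ c) xs ys)) (length-++ (filter (λ a → κ a ≟ c) xs))

countColour-map : ∀ {A B : Set} (κ : B → ℕ) c (f : A → B) xs →
                  countColour κ c (map f xs) ≡ countColour (κ ∘ f) c xs
countColour-map κ c f []       = refl
countColour-map κ c f (x ∷ xs) with κ (f x) ≟ c
... | yes κfx≡c = begin
  length (filter (λ b → κ b ≟ c) (f x ∷ map f xs))  ≡⟨ cong length (filter-accept (λ b → κ b ≟ c) κfx≡c) ⟩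
  suc (countColour κ c (map f xs))                   ≡⟨ cong suc (countColour-map κ c f xs) ⟩
  suc (countColour (κ ∘ f) c xs)                     ≡⟨ cong length (filter-accept (λ a → κ (f a) ≟ c) κfx≡c) ⟨
  countColour (κ ∘ f) c (x ∷ xs)                     ∎
  where open ≡-Reasoning
... | no κfx≢c = begin
  length (filter (λ b → κ b ≟ c) (f x ∷ map f xs))  ≡⟨ cong length (filter-reject (λ b → κ b ≟ c) κfx≢c) ⟩
  countColour κ c (map f xs)                         ≡⟨ countColour-map κ c f xs ⟩
  countColour (κ ∘ f) c xs                           ≡⟨ cong length (filter-reject (λ a → κ (f a) ≟ c) κfx≢c) ⟨
  countColour (κ ∘ f) c (x ∷ xs)                     ∎
  where open ≡-Reasoning

countColour-cong : ∀ {A : Set} {κ κ′ : A → ℕ} {c c′} xs →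
                   (∀ a → κ a ≡ c → κ′ a ≡ c′) → (∀ a → κ′ a ≡ c′ → κ a ≡ c) →
                   countColour κ c xs ≡ countColour κ′ c′ xs
countColour-cong {κ = κ} {κ′} {c} {c′} xs to from =
  cong length (filter-≐ (λ a → κ a ≟ c) (λ a → κ′ a ≟ c′) ((λ {a} → to a) , (λ {a} → from a)) xs)

countColour-≗ : ∀ {A : Set} {κ κ′ : A → ℕ} c xs → (∀ a → κ a ≡ κ′ a) → countColour κ c xs ≡ countColour κ′ c xs
countColour-≗ c xs κ≗κ′ = countColour-cong xs (λ a → trans (sym (κ≗κ′ a))) (λ a → trans (κ≗κ′ a))

tabulate-+ : ∀ {A : Set} a s (f : Fin (a + s) → A) →
             tabulate f ≡ tabulate (f ∘ (_↑ˡ s)) ++ tabulate (f ∘ (a ↑ʳ_))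
tabulate-+ zero    s f = refl
tabulate-+ (suc a) s f = cong (f Fin.zero ∷_) (tabulate-+ a s (f ∘ Fin.suc))

colourCount-+ : ∀ a s (κ : Fin (a + s) → ℕ) c →
                colourCount κ c ≡ colourCount (κ ∘ (_↑ˡ s)) c + colourCount (κ ∘ (a ↑ʳ_)) c
colourCount-+ a s κ c = begin
  countColour κ c (allFin (a + s))
    ≡⟨ cong (countColour κ c) (tabulate-+ a s (λ x → x)) ⟩
  countColour κ c (tabulate (_↑ˡ s) ++ tabulate (a ↑ʳ_))
    ≡⟨ countColour-++ κ c (tabulate (_↑ˡ s)) (tabulate (a ↑ʳ_)) ⟩
  countColour κ c (tabulate (_↑ˡ s)) + countColour κ c (tabulate (a ↑ʳ_))
    ≡⟨ cong₂ (λ xs ys → countColour κ c xs + countColour κ c ys)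
             (map-tabulate (λ x → x) (_↑ˡ s)) (map-tabulate (λ x → x) (a ↑ʳ_)) ⟨
  countColour κ c (map (_↑ˡ s) (allFin a)) + countColour κ c (map (a ↑ʳ_) (allFin s))
    ≡⟨ cong₂ _+_ (countColour-map κ c (_↑ˡ s) (allFin a)) (countColour-map κ c (a ↑ʳ_) (allFin s)) ⟩
  colourCount (κ ∘ (_↑ˡ s)) c + colourCount (κ ∘ (a ↑ʳ_)) c ∎
  where open ≡-Reasoning

sum-tabulate-+ : ∀ {m} (f g : Fin m → ℕ) →
                 sum (tabulate (λ c → f c + g c)) ≡ sum (tabulate f) + sum (tabulate g)
sum-tabulate-+ {zero}  f g = refl
sum-tabulate-+ {suc m} f g =
  trans (cong (f Fin.zero + g Fin.zero +_) (sum-tabulate-+ (f ∘ Fin.suc) (g ∘ Fin.suc)))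
        (interchange (f Fin.zero) (g Fin.zero) (sum (tabulate (f ∘ Fin.suc))) (sum (tabulate (g ∘ Fin.suc))))

sum-tabulate-0 : ∀ {m} (f : Fin m → ℕ) → (∀ c → f c ≡ 0) → sum (tabulate f) ≡ 0
sum-tabulate-0 {zero}  f f≡0 = refl
sum-tabulate-0 {suc m} f f≡0 = cong₂ _+_ (f≡0 Fin.zero) (sum-tabulate-0 (f ∘ Fin.suc) (f≡0 ∘ Fin.suc))

sum-tabulate-δ : ∀ m k → k < m → (g : ℕ → ℕ) → g k ≡ 1 → (∀ j → j ≢ k → g j ≡ 0) →
                 sum (tabulate {n = m} (g ∘ toℕ)) ≡ 1
sum-tabulate-δ (suc m) zero    _         g gk≡1 g≡0 =
  cong₂ _+_ gk≡1 (sum-tabulate-0 {m} _ (λ c → g≡0 (suc (toℕ c)) λ ()))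
sum-tabulate-δ (suc m) (suc k) (s≤s k<m) g gk≡1 g≡0 =
  cong₂ _+_ (g≡0 0 λ ()) (sum-tabulate-δ m k k<m (g ∘ suc) gk≡1 (λ j j≢k → g≡0 (suc j) (j≢k ∘ suc-injective)))

sum-countColours : ∀ {A : Set} m (κ : A → ℕ) xs → (∀ a → κ a < m) →
                   sum (tabulate {n = m} (λ c → countColour κ (toℕ c) xs)) ≡ length xs
sum-countColours m κ []       κ<m = sum-tabulate-0 {m} _ (λ _ → refl)
sum-countColours m κ (x ∷ xs) κ<m = begin
  sum (tabulate {n = m} (λ c → countColour κ (toℕ c) (x ∷ xs)))
    ≡⟨ cong sum (tabulate-cong {n = m} (λ c → countColour-++ κ (toℕ c) [ x ] xs)) ⟩
  sum (tabulate {n = m} (λ c → countColour κ (toℕ c) [ x ] + countColour κ (toℕ c) xs))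
    ≡⟨ sum-tabulate-+ {m} (λ c → countColour κ (toℕ c) [ x ]) (λ c → countColour κ (toℕ c) xs) ⟩
  sum (tabulate {n = m} (λ c → countColour κ (toℕ c) [ x ])) +
  sum (tabulate {n = m} (λ c → countColour κ (toℕ c) xs))
    ≡⟨ cong₂ _+_ (sum-tabulate-δ m (κ x) (κ<m x) (λ j → countColour κ j [ x ]) x-counted others-empty)
                 (sum-countColours m κ xs κ<m) ⟩
  suc (length xs) ∎
  where
  open ≡-Reasoning
  x-counted : countColour κ (κ x) [ x ] ≡ 1
  x-counted = cong length (filter-accept (λ a → κ a ≟ κ x) refl)
  others-empty : ∀ j → j ≢ κ x → countColour κ j [ x ] ≡ 0
  others-empty j j≢κx = cong length (filter-reject (λ a → κ a ≟ j) (j≢κx ∘ sym))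

content≡tabulate : ∀ {v} m (κ : Fin v → ℕ) → content m κ ≡ tabulate (λ c → colourCount κ (toℕ c))
content≡tabulate m κ = map-tabulate (λ c → c) (λ c → colourCount κ (toℕ c))

sum-content : ∀ {v} m (κ : Fin v → ℕ) → (∀ a → κ a < m) → sum (content m κ) ≡ v
sum-content {v} m κ κ<m =
  trans (cong sum (content≡tabulate m κ))
        (trans (sum-countColours m κ (allFin v) κ<m) (length-tabulate (λ a → a)))

expo-tabulate : ∀ {m} (h : Fin m → ℕ) c → expo (tabulate h) (toℕ c) ≡ h c
expo-tabulate h Fin.zero    = refl
expo-tabulate h (Fin.suc c) = expo-tabulate (h ∘ Fin.suc) c

tabulate≡ : ∀ {m} (h : Fin m → ℕ) e → length e ≡ m → (∀ c → h c ≡ expo e (toℕ c)) → tabulate h ≡ e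
tabulate≡ {zero}  h []      refl h≡e = refl
tabulate≡ {suc m} h (x ∷ e) refl h≡e = cong₂ _∷_ (h≡e Fin.zero) (tabulate≡ (h ∘ Fin.suc) e refl (h≡e ∘ Fin.suc))

content≡ : ∀ {v} m (κ : Fin v → ℕ) e → length e ≡ m →
           (∀ (c : Fin m) → colourCount κ (toℕ c) ≡ expo e (toℕ c)) → content m κ ≡ e
content≡ m κ e |e|≡m counts = trans (content≡tabulate m κ) (tabulate≡ _ e |e|≡m counts)

content≡⇒colourCount : ∀ {v} m (κ : Fin v → ℕ) {e} → content m κ ≡ e →
                       ∀ (c : Fin m) → colourCount κ (toℕ c) ≡ expo e (toℕ c)
content≡⇒colourCount m κ refl c =
  sym (trans (cong (λ l → expo l (toℕ c)) (content≡tabulate m κ)) (expo-tabulate _ c))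

content-≗ : ∀ {v} m {κ κ′ : Fin v → ℕ} → (∀ a → κ a ≡ κ′ a) → content m κ ≡ content m κ′
content-≗ {v} m κ≗κ′ = map-cong (λ c → countColour-≗ (toℕ c) (allFin v) κ≗κ′) (allFin m)

colouringOf : ∀ {v m} → Vec (Fin m) v → Fin v → ℕ
colouringOf κ a = toℕ (Vec.lookup κ a)

ProperWithContent : ∀ {v} → Digraph v → (m : ℕ) → List ℕ → Vec (Fin m) v → Set
ProperWithContent G m e κ = IsProper G (colouringOf κ) × content m (colouringOf κ) ≡ e

properWithContent? : ∀ {v} (G : Digraph v) m e (κ : Vec (Fin m) v) → Dec (ProperWithContent G m e κ)
properWithContent? G m e κ = isProper? G (colouringOf κ) ×-dec ≡-dec _≟_ (content m (colouringOf κ)) e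

colourings : ∀ {v} → Digraph v → (m : ℕ) → List ℕ → List (Vec (Fin m) v)
colourings {v} G m e = filter (properWithContent? G m e) (allMaps v m)

module _ {v} (G : Digraph v) (m : ℕ) (e : List ℕ) where

  colourings-unique : Unique (colourings G m e)
  colourings-unique = Uniqueₚ.filter⁺ (properWithContent? G m e) (allMaps-unique v m)

  ∈-colourings⁺ : ∀ {κ} → ProperWithContent G m e κ → κ ∈ colourings G m e
  ∈-colourings⁺ {κ} = ∈-filter⁺ (properWithContent? G m e) (∈-allMaps κ)

  ∈-colourings⁻ : ∀ {κ} → κ ∈ colourings G m e → ProperWithContent G m e κ
  ∈-colourings⁻ κ∈ = proj₂ (∈-filter⁻ (properWithContent? G m e) {xs = allMaps v m} κ∈)

  colourings-empty : (∀ κ → ¬ ProperWithContent G m e κ) → length (colourings G m e) ≡ 0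
  colourings-empty invalid =
    cong length (filter-none (properWithContent? G m e) (All.universal invalid (allMaps v m)))

IsProper-≗ : ∀ {v} (G : Digraph v) {κ κ′ : Fin v → ℕ} → (∀ a → κ a ≡ κ′ a) → IsProper G κ → IsProper G κ′
IsProper-≗ G κ≗κ′ proper a b = subst₂ (Compat (edge G a b)) (κ≗κ′ a) (κ≗κ′ b) (proper a b)

chromCoeff-homogeneous : ∀ {v} (G : Digraph v) e → sum e ≢ v → chromCoeff G e ≡ 0
chromCoeff-homogeneous G e sum≢v = colourings-empty G (length e) e λ κ (_ , content≡e) →
  sum≢v (trans (cong sum (sym content≡e))
               (sum-content (length e) (colouringOf κ) (λ a → Finₚ.toℕ<n (Vec.lookup κ a))))

-- Quasisymmetry of 𝒳_G

module _ {φ : ℕ → ℕ} (φ-mono-< : ∀ {x y} → x < y → φ x < φ y) where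

  private
    φ-mono-≤ : ∀ {x y} → x ≤ y → φ x ≤ φ y
    φ-mono-≤ x≤y = [ <⇒≤ ∘ φ-mono-< , (λ { refl → ≤-refl }) ]′ (m≤n⇒m<n∨m≡n x≤y)

    φ-cancel-< : ∀ {x y} → φ x < φ y → x < y
    φ-cancel-< φx<φy = ≰⇒> (λ y≤x → <⇒≱ φx<φy (φ-mono-≤ y≤x))

    φ-cancel-≤ : ∀ {x y} → φ x ≤ φ y → x ≤ y
    φ-cancel-≤ φx≤φy = ≮⇒≥ (λ y<x → <⇒≱ (φ-mono-< y<x) φx≤φy)

  strictMono-injective : ∀ {x y} → φ x ≡ φ y → x ≡ y
  strictMono-injective φx≡φy = ≤-antisym (φ-cancel-≤ (≤-reflexive φx≡φy)) (φ-cancel-≤ (≤-reflexive (sym φx≡φy)))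

  compat-strictMono : ∀ t {x y} → Compat t x y → Compat t (φ x) (φ y)
  compat-strictMono nothing       _     = tt
  compat-strictMono (just dashed) x≢y   = x≢y ∘ strictMono-injective
  compat-strictMono (just solid)  x<y   = φ-mono-< x<y
  compat-strictMono (just double) x≤y   = φ-mono-≤ x≤y

  compat-strictMono⁻ : ∀ t {x y} → Compat t (φ x) (φ y) → Compat t x y
  compat-strictMono⁻ nothing       _       = tt
  compat-strictMono⁻ (just dashed) φx≢φy   = φx≢φy ∘ cong φ
  compat-strictMono⁻ (just solid)  φx<φy   = φ-cancel-< φx<φy
  compat-strictMono⁻ (just double) φx≤φy   = φ-cancel-≤ φx≤φy

skip : ℕ → ℕ → ℕ
skip zero    c       = suc c
skip (suc p) zero    = zero
skip (suc p) (suc c) = suc (skip p c)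

skip-mono-< : ∀ p {x y} → x < y → skip p x < skip p y
skip-mono-< zero    x<y                       = s≤s x<y
skip-mono-< (suc p) {zero}  {suc y} _         = s≤s z≤n
skip-mono-< (suc p) {suc x} {suc y} (s≤s x<y) = s≤s (skip-mono-< p x<y)

skip-≢ : ∀ p x → skip p x ≢ p
skip-≢ (suc p) (suc x) eq = skip-≢ p x (suc-injective eq)

toℕ-punchIn : ∀ {m} (i : Fin (suc m)) (j : Fin m) → toℕ (punchIn i j) ≡ skip (toℕ i) (toℕ j)
toℕ-punchIn Fin.zero    j           = refl
toℕ-punchIn (Fin.suc i) Fin.zero    = refl
toℕ-punchIn (Fin.suc i) (Fin.suc j) = cong suc (toℕ-punchIn i j)

expo-skip : ∀ p x s j → expo (p ++ x ∷ s) (skip (length p) j) ≡ expo (p ++ s) j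
expo-skip []      x s j       = refl
expo-skip (y ∷ p) x s zero    = refl
expo-skip (y ∷ p) x s (suc j) = expo-skip p x s j

expo-length : ∀ p x s → expo (p ++ x ∷ s) (length p) ≡ x
expo-length []      x s = refl
expo-length (y ∷ p) x s = expo-length p x s

length-insert : ∀ (p : List ℕ) x s → length (p ++ x ∷ s) ≡ suc (length (p ++ s))
length-insert []      x s = refl
length-insert (y ∷ p) x s = cong suc (length-insert p x s)

-- Proper colourings with content p ++ 0 ∷ s never use the colour |p|, so punching
-- that colour in is a bijection onto them from those with content p ++ s.
module ZeroInsertion {v} (G : Digraph v) (p s : List ℕ) where

  private
    m : ℕ
    m = length (p ++ s)

    P : ℕ
    P = length p

    gap : Fin (suc m)
    gap = fromℕ< (s≤s (subst (P ≤_) (sym (length-++ p)) (m≤m+n P (length s))))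

    toℕ-gap : toℕ gap ≡ P
    toℕ-gap = Finₚ.toℕ-fromℕ< _

    shift : Vec (Fin m) v → Vec (Fin (suc m)) v
    shift = Vec.map (punchIn gap)

    shift-injective : ∀ {κ κ′} → shift κ ≡ shift κ′ → κ ≡ κ′
    shift-injective {κ} {κ′} eq = lookup-ext λ a → Finₚ.punchIn-injective gap _ _ (begin
      punchIn gap (Vec.lookup κ a)   ≡⟨ Vecₚ.lookup-map a _ κ ⟨
      Vec.lookup (shift κ) a         ≡⟨ cong (λ w → Vec.lookup w a) eq ⟩
      Vec.lookup (shift κ′) a        ≡⟨ Vecₚ.lookup-map a _ κ′ ⟩
      punchIn gap (Vec.lookup κ′ a)  ∎)
      where open ≡-Reasoning

    colouringOf-shift : ∀ κ a → colouringOf (shift κ) a ≡ skip P (colouringOf κ a)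
    colouringOf-shift κ a = begin
      toℕ (Vec.lookup (Vec.map (punchIn gap) κ) a)  ≡⟨ cong toℕ (Vecₚ.lookup-map a (punchIn gap) κ) ⟩
      toℕ (punchIn gap (Vec.lookup κ a))            ≡⟨ toℕ-punchIn gap _ ⟩
      skip (toℕ gap) (colouringOf κ a)              ≡⟨ cong (λ q → skip q (colouringOf κ a)) toℕ-gap ⟩
      skip P (colouringOf κ a)                      ∎
      where open ≡-Reasoning

    colourCount-shift : ∀ κ c → colourCount (colouringOf (shift κ)) (skip P c) ≡ colourCount (colouringOf κ) c
    colourCount-shift κ c = countColour-cong (allFin v)
      (λ a eq → strictMono-injective (skip-mono-< P) (trans (sym (colouringOf-shift κ a)) eq))
      (λ a eq → trans (colouringOf-shift κ a) (cong (skip P) eq))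

    colourCount-shift-gap : ∀ κ → colourCount (colouringOf (shift κ)) P ≡ 0
    colourCount-shift-gap κ = countColour-none (colouringOf (shift κ)) P (allFin v)
      (λ a eq → skip-≢ P (colouringOf κ a) (trans (sym (colouringOf-shift κ a)) eq))

    toℕ-punchIn-gap : ∀ c → toℕ (punchIn gap c) ≡ skip P (toℕ c)
    toℕ-punchIn-gap c = trans (toℕ-punchIn gap c) (cong (λ q → skip q (toℕ c)) toℕ-gap)

  shift-valid : ∀ κ → ProperWithContent G m (p ++ s) κ → ProperWithContent G (suc m) (p ++ 0 ∷ s) (shift κ)
  shift-valid κ (proper , hasContent) =
    IsProper-≗ G (sym ∘ colouringOf-shift κ)
      (λ a b → compat-strictMono (skip-mono-< P) (edge G a b) (proper a b)) ,
    content≡ (suc m) (colouringOf (shift κ)) (p ++ 0 ∷ s) (length-insert p 0 s) counts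
    where
    counts : ∀ (c : Fin (suc m)) → colourCount (colouringOf (shift κ)) (toℕ c) ≡ expo (p ++ 0 ∷ s) (toℕ c)
    counts c with gap Finₚ.≟ c
    ... | yes refl = begin
      colourCount (colouringOf (shift κ)) (toℕ gap)  ≡⟨ cong (colourCount (colouringOf (shift κ))) toℕ-gap ⟩
      colourCount (colouringOf (shift κ)) P          ≡⟨ colourCount-shift-gap κ ⟩
      0                                              ≡⟨ expo-length p 0 s ⟨
      expo (p ++ 0 ∷ s) P                            ≡⟨ cong (expo (p ++ 0 ∷ s)) toℕ-gap ⟨
      expo (p ++ 0 ∷ s) (toℕ gap)                    ∎
      where open ≡-Reasoning
    ... | no gap≢c = begin
      colourCount (colouringOf (shift κ)) (toℕ c)    ≡⟨ cong (colourCount (colouringOf (shift κ))) c≡skip ⟩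
      colourCount (colouringOf (shift κ)) (skip P j) ≡⟨ colourCount-shift κ j ⟩
      colourCount (colouringOf κ) j                  ≡⟨ content≡⇒colourCount m (colouringOf κ) hasContent c′ ⟩
      expo (p ++ s) j                                ≡⟨ expo-skip p 0 s j ⟨
      expo (p ++ 0 ∷ s) (skip P j)                   ≡⟨ cong (expo (p ++ 0 ∷ s)) c≡skip ⟨
      expo (p ++ 0 ∷ s) (toℕ c)                      ∎
      where
      open ≡-Reasoning
      c′ : Fin m
      c′ = punchOut gap≢c
      j : ℕ
      j = toℕ c′
      c≡skip : toℕ c ≡ skip P j
      c≡skip = trans (cong toℕ (sym (Finₚ.punchIn-punchOut gap≢c))) (toℕ-punchIn-gap c′)

  shift-valid⁻ : ∀ κ → ProperWithContent G (suc m) (p ++ 0 ∷ s) (shift κ) → ProperWithContent G m (p ++ s) κ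
  shift-valid⁻ κ (proper , hasContent) =
    (λ a b → compat-strictMono⁻ (skip-mono-< P) (edge G a b) (IsProper-≗ G (colouringOf-shift κ) proper a b)) ,
    content≡ m (colouringOf κ) (p ++ s) refl (λ c → begin
      colourCount (colouringOf κ) (toℕ c)
        ≡⟨ colourCount-shift κ (toℕ c) ⟨
      colourCount (colouringOf (shift κ)) (skip P (toℕ c))
        ≡⟨ cong (colourCount (colouringOf (shift κ))) (toℕ-punchIn-gap c) ⟨
      colourCount (colouringOf (shift κ)) (toℕ (punchIn gap c))
        ≡⟨ content≡⇒colourCount (suc m) (colouringOf (shift κ)) hasContent (punchIn gap c) ⟩
      expo (p ++ 0 ∷ s) (toℕ (punchIn gap c))
        ≡⟨ cong (expo (p ++ 0 ∷ s)) (toℕ-punchIn-gap c) ⟩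
      expo (p ++ 0 ∷ s) (skip P (toℕ c))
        ≡⟨ expo-skip p 0 s (toℕ c) ⟩
      expo (p ++ s) (toℕ c) ∎)
    where open ≡-Reasoning

  unshift : ∀ κ → ProperWithContent G (suc m) (p ++ 0 ∷ s) κ → ∃ λ κ′ → shift κ′ ≡ κ
  unshift κ (_ , hasContent) = κ′ , lookup-ext λ a → begin
    Vec.lookup (shift κ′) a                ≡⟨ Vecₚ.lookup-map a (punchIn gap) κ′ ⟩
    punchIn gap (Vec.lookup κ′ a)          ≡⟨ cong (punchIn gap) (Vecₚ.lookup∘tabulate _ a) ⟩
    punchIn gap (punchOut (avoids-gap a))  ≡⟨ Finₚ.punchIn-punchOut (avoids-gap a) ⟩
    Vec.lookup κ a                         ∎
    where
    open ≡-Reasoning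
    gap-unused : colourCount (colouringOf κ) (toℕ gap) ≡ 0
    gap-unused = trans (content≡⇒colourCount (suc m) (colouringOf κ) hasContent gap)
                       (trans (cong (expo (p ++ 0 ∷ s)) toℕ-gap) (expo-length p 0 s))
    avoids-gap : ∀ a → gap ≢ Vec.lookup κ a
    avoids-gap a gap≡κa =
      countColour≡0⇒ (colouringOf κ) (toℕ gap) gap-unused (∈-allFin a) (cong toℕ (sym gap≡κa))
    κ′ : Vec (Fin m) v
    κ′ = Vec.tabulate (punchOut ∘ avoids-gap)

  colourings-length : length (colourings G (suc m) (p ++ 0 ∷ s)) ≡ length (colourings G m (p ++ s))
  colourings-length = trans
    (unique⇒length-≡ (colourings-unique G (suc m) _)
                     (Uniqueₚ.map⁺ shift-injective (colourings-unique G m _))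
                     (mk⇔ to from))
    (length-map shift (colourings G m (p ++ s)))
    where
    to : ∀ {κ} → κ ∈ colourings G (suc m) (p ++ 0 ∷ s) → κ ∈ map shift (colourings G m (p ++ s))
    to {κ} κ∈ with valid ← ∈-colourings⁻ G (suc m) _ κ∈ | unshift κ valid
    ... | κ′ , refl = ∈-map⁺ shift (∈-colourings⁺ G m _ (shift-valid⁻ κ′ valid))
    from : ∀ {κ} → κ ∈ map shift (colourings G m (p ++ s)) → κ ∈ colourings G (suc m) (p ++ 0 ∷ s)
    from κ∈ with ∈-map⁻ shift κ∈
    ... | κ′ , κ′∈ , refl = ∈-colourings⁺ G (suc m) _ (shift-valid κ′ (∈-colourings⁻ G m _ κ′∈))

chromCoeff-insert0 : ∀ {v} (G : Digraph v) p s → chromCoeff G (p ++ 0 ∷ s) ≡ chromCoeff G (p ++ s)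
chromCoeff-insert0 G p s =
  trans (cong (λ m → length (colourings G m (p ++ 0 ∷ s))) (length-insert p 0 s))
        (ZeroInsertion.colourings-length G p s)

chromCoeff-removeZeros : ∀ {v} (G : Digraph v) p e → chromCoeff G (p ++ e) ≡ chromCoeff G (p ++ removeZeros e)
chromCoeff-removeZeros G p []          = refl
chromCoeff-removeZeros G p (zero ∷ e)  = trans (chromCoeff-insert0 G p e) (chromCoeff-removeZeros G p e)
chromCoeff-removeZeros G p (suc x ∷ e) = begin
  chromCoeff G (p ++ suc x ∷ e)                     ≡⟨ cong (chromCoeff G) (++-assoc p [ suc x ] e) ⟨
  chromCoeff G ((p ++ [ suc x ]) ++ e)              ≡⟨ chromCoeff-removeZeros G (p ++ [ suc x ]) e ⟩
  chromCoeff G ((p ++ [ suc x ]) ++ removeZeros e)  ≡⟨ cong (chromCoeff G) (++-assoc p [ suc x ] _) ⟩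
  chromCoeff G (p ++ suc x ∷ removeZeros e)         ∎
  where open ≡-Reasoning

chromCoeff-quasisymmetric : ∀ {v} (G : Digraph v) e e′ → removeZeros e ≡ removeZeros e′ →
                            chromCoeff G e ≡ chromCoeff G e′
chromCoeff-quasisymmetric G e e′ eq =
  trans (chromCoeff-removeZeros G [] e) (trans (cong (chromCoeff G) eq) (sym (chromCoeff-removeZeros G [] e′)))

isQSym : ∀ {n} (f : Series) → (∀ e → sum e ≢ n → f e ≡ 0ℚ) →
         (∀ e e′ → removeZeros e ≡ removeZeros e′ → f e ≡ f e′) → IsQSym n f
isQSym {n} f vanishes quasisymmetric =
  (λ e fe≢0 → decidable-stable (sum e ≟ n) (fe≢0 ∘ vanishes e)) , quasisymmetric

IsQSym-vanishes : ∀ {n f} → IsQSym n f → ∀ e → sum e ≢ n → f e ≡ 0ℚ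
IsQSym-vanishes (homogeneous , _) e sum≢n = decidable-stable (_ ≟ℚ 0ℚ) (sum≢n ∘ homogeneous e)

𝒳-≡ : ∀ {v} (G : Digraph v) e {k} → chromCoeff G e ≡ k → 𝒳 G e ≡ (ℤ+ k) / 1
𝒳-≡ G e = cong (λ k → (ℤ+ k) / 1)

𝒳-isQSym : ∀ {v} (G : Digraph v) → IsQSym v (𝒳 G)
𝒳-isQSym G = isQSym (𝒳 G)
  (λ e sum≢v → 𝒳-≡ G e (chromCoeff-homogeneous G e sum≢v))
  (λ e e′ eq → 𝒳-≡ G e (chromCoeff-quasisymmetric G e e′ eq))

-- Ordinal sums

data JoinView (a s : ℕ) : Fin (a + s) → Set where
  left  : (i : Fin a) → JoinView a s (i ↑ˡ s)
  right : (j : Fin s) → JoinView a s (a ↑ʳ j)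

joinView : ∀ a s (x : Fin (a + s)) → JoinView a s x
joinView zero    s x           = right x
joinView (suc a) s Fin.zero    = left Fin.zero
joinView (suc a) s (Fin.suc x) with joinView a s x
... | left i  = left (Fin.suc i)
... | right j = right j

module _ {m k} (G : Digraph m) (H : Digraph k) where

  join-edge-ˡˡ : ∀ i j → edge (join G H) (i ↑ˡ k) (j ↑ˡ k) ≡ edge G i j
  join-edge-ˡˡ i j rewrite Finₚ.splitAt-↑ˡ m i k | Finₚ.splitAt-↑ˡ m j k = refl

  join-edge-ˡʳ : ∀ i j → edge (join G H) (i ↑ˡ k) (m ↑ʳ j) ≡ just solid
  join-edge-ˡʳ i j rewrite Finₚ.splitAt-↑ˡ m i k | Finₚ.splitAt-↑ʳ m k j = refl

  join-edge-ʳˡ : ∀ i j → edge (join G H) (m ↑ʳ i) (j ↑ˡ k) ≡ nothing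
  join-edge-ʳˡ i j rewrite Finₚ.splitAt-↑ʳ m k i | Finₚ.splitAt-↑ˡ m j k = refl

  join-edge-ʳʳ : ∀ i j → edge (join G H) (m ↑ʳ i) (m ↑ʳ j) ≡ edge H i j
  join-edge-ʳʳ i j rewrite Finₚ.splitAt-↑ʳ m k i | Finₚ.splitAt-↑ʳ m k j = refl

  module _ {κ : Fin (m + k) → ℕ} where

    join-proper : IsProper G (κ ∘ (_↑ˡ k)) → IsProper H (κ ∘ (m ↑ʳ_)) →
                  (∀ i j → κ (i ↑ˡ k) < κ (m ↑ʳ j)) → IsProper (join G H) κ
    join-proper properG properH increasing x y with joinView m k x | joinView m k y
    ... | left i  | left j  = subst (λ t → Compat t _ _) (sym (join-edge-ˡˡ i j)) (properG i j)
    ... | left i  | right j = subst (λ t → Compat t _ _) (sym (join-edge-ˡʳ i j)) (increasing i j)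
    ... | right i | left j  = subst (λ t → Compat t _ _) (sym (join-edge-ʳˡ i j)) tt
    ... | right i | right j = subst (λ t → Compat t _ _) (sym (join-edge-ʳʳ i j)) (properH i j)

    join-proper-ʳ : IsProper (join G H) κ → IsProper H (κ ∘ (m ↑ʳ_))
    join-proper-ʳ proper i j = subst (λ t → Compat t _ _) (join-edge-ʳʳ i j) (proper (m ↑ʳ i) (m ↑ʳ j))

    join-proper-< : IsProper (join G H) κ → ∀ i j → κ (i ↑ˡ k) < κ (m ↑ʳ j)
    join-proper-< proper i j = subst (λ t → Compat t _ _) (join-edge-ˡʳ i j) (proper (i ↑ˡ k) (m ↑ʳ j))

constant-proper : ∀ {v} (G : Digraph v) → AllEdgesDouble G → ∀ d → IsProper G (λ _ → d)
constant-proper G allDouble d a b with edge G a b | allDouble a b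
... | _ | inj₁ refl = tt
... | _ | inj₂ refl = ≤-refl

-- Block p of F_α (counting from 0) gets the colour d + p.
blockColouring : ∀ α → ℕ → Fin (sum α) → ℕ
blockColouring []      d ()
blockColouring (a ∷ α) d x = [ (λ _ → d) , blockColouring α (suc d) ]′ (splitAt a x)

module _ (a : ℕ) (α : List ℕ) (d : ℕ) where

  blockColouring-ˡ : ∀ i → blockColouring (a ∷ α) d (i ↑ˡ sum α) ≡ d
  blockColouring-ˡ i rewrite Finₚ.splitAt-↑ˡ a i (sum α) = refl

  blockColouring-ʳ : ∀ j → blockColouring (a ∷ α) d (a ↑ʳ j) ≡ blockColouring α (suc d) j
  blockColouring-ʳ j rewrite Finₚ.splitAt-↑ʳ a (sum α) j = refl

blockColouring-≥ : ∀ α d x → d ≤ blockColouring α d x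
blockColouring-≥ (a ∷ α) d x with joinView a (sum α) x
... | left i  = ≤-reflexive (sym (blockColouring-ˡ a α d i))
... | right j =
  ≤-trans (n≤1+n d) (subst (suc d ≤_) (sym (blockColouring-ʳ a α d j)) (blockColouring-≥ α (suc d) j))

blockColouring-< : ∀ α d x → blockColouring α d x < d + length α
blockColouring-< (a ∷ α) d x with joinView a (sum α) x
... | left i  =
  subst₂ _<_ (sym (blockColouring-ˡ a α d i)) (sym (+-suc d (length α))) (s≤s (m≤m+n d (length α)))
... | right j =
  subst₂ _<_ (sym (blockColouring-ʳ a α d j)) (sym (+-suc d (length α))) (blockColouring-< α (suc d) j)

blockColouring-proper : (F : (i : ℕ) → Digraph i) → (∀ i → 0 < i → AllEdgesDouble (F i)) →
                        ∀ α → All (0 <_) α → ∀ d → IsProper (ordinalSum F α) (blockColouring α d)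
blockColouring-proper F F-double []      []         d ()
blockColouring-proper F F-double (a ∷ α) (a>0 ∷ α>0) d = join-proper (F a) (ordinalSum F α)
  (IsProper-≗ (F a) (sym ∘ blockColouring-ˡ a α d) (constant-proper (F a) (F-double a a>0) d))
  (IsProper-≗ (ordinalSum F α) (sym ∘ blockColouring-ʳ a α d) (blockColouring-proper F F-double α α>0 (suc d)))
  (λ i j → subst₂ _<_ (sym (blockColouring-ˡ a α d i)) (sym (blockColouring-ʳ a α d j))
                      (blockColouring-≥ α (suc d) j))

colourCount-blockColouring-< : ∀ α d c → c < d → colourCount (blockColouring α d) c ≡ 0
colourCount-blockColouring-< α d c c<d = countColour-none (blockColouring α d) c (allFin (sum α))
  (λ x eq → <-irrefl refl (≤-trans c<d (subst (d ≤_) eq (blockColouring-≥ α d x))))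

colourCount-blockColouring-∷ : ∀ a α d c → colourCount (blockColouring (a ∷ α) d) c ≡
                               countColour (λ _ → d) c (allFin a) + colourCount (blockColouring α (suc d)) c
colourCount-blockColouring-∷ a α d c = trans (colourCount-+ a (sum α) (blockColouring (a ∷ α) d) c)
  (cong₂ _+_ (countColour-≗ c (allFin a) (blockColouring-ˡ a α d))
             (countColour-≗ c (allFin (sum α)) (blockColouring-ʳ a α d)))

colourCount-blockColouring : ∀ α d j → colourCount (blockColouring α d) (d + j) ≡ expo α j
colourCount-blockColouring []      d j       = refl
colourCount-blockColouring (a ∷ α) d zero    = begin
  colourCount (blockColouring (a ∷ α) d) (d + 0)
    ≡⟨ colourCount-blockColouring-∷ a α d (d + 0) ⟩
  countColour (λ _ → d) (d + 0) (allFin a) + colourCount (blockColouring α (suc d)) (d + 0)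
    ≡⟨ cong₂ _+_ (countColour-all _ (d + 0) (allFin a) (λ _ → sym (+-identityʳ d)))
                 (colourCount-blockColouring-< α (suc d) (d + 0) (s≤s (≤-reflexive (+-identityʳ d)))) ⟩
  length (allFin a) + 0
    ≡⟨ trans (+-identityʳ _) (length-tabulate (λ i → i)) ⟩
  a ∎
  where open ≡-Reasoning
colourCount-blockColouring (a ∷ α) d (suc j) = begin
  colourCount (blockColouring (a ∷ α) d) (d + suc j)
    ≡⟨ colourCount-blockColouring-∷ a α d (d + suc j) ⟩
  countColour (λ _ → d) (d + suc j) (allFin a) + colourCount (blockColouring α (suc d)) (d + suc j)
    ≡⟨ cong (_+ colourCount (blockColouring α (suc d)) (d + suc j))
            (countColour-none _ (d + suc j) (allFin a) (λ _ → m+1+n≢m d ∘ sym)) ⟩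
  colourCount (blockColouring α (suc d)) (d + suc j)
    ≡⟨ cong (colourCount (blockColouring α (suc d))) (+-suc d j) ⟩
  colourCount (blockColouring α (suc d)) (suc d + j)
    ≡⟨ colourCount-blockColouring α (suc d) j ⟩
  expo α j ∎
  where open ≡-Reasoning

content-blockColouring : ∀ α → content (length α) (blockColouring α 0) ≡ α
content-blockColouring α =
  content≡ (length α) (blockColouring α 0) α refl (colourCount-blockColouring α 0 ∘ toℕ)

module _ (F : (i : ℕ) → Digraph i) where

  -- Choosing one vertex from each block gives a solid path, so the colours must increase along it.
  colour-range : ∀ α → All (0 <_) α → (κ : Fin (sum α) → ℕ) → IsProper (ordinalSum F α) κ →
                 ∀ {d m} → d ≤ m → (∀ x → d ≤ κ x) → (∀ x → κ x < m) → d + length α ≤ m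
  colour-range []          []          κ proper {d} {m} d≤m _ _ = subst (_≤ m) (sym (+-identityʳ d)) d≤m
  colour-range (zero ∷ α)  (() ∷ _)
  colour-range (suc a ∷ α) (_ ∷ α>0) κ proper {d} {m} d≤m κ≥d κ<m = begin
    d + suc (length α)     ≡⟨ +-suc d (length α) ⟩
    suc d + length α       ≤⟨ +-monoˡ-≤ (length α) (s≤s (κ≥d x₀)) ⟩
    suc (κ x₀) + length α  ≤⟨ colour-range α α>0 (κ ∘ (suc a ↑ʳ_)) (join-proper-ʳ _ _ proper)
                                (κ<m x₀) (join-proper-< _ _ proper Fin.zero) (κ<m ∘ (suc a ↑ʳ_)) ⟩
    m                      ∎
    where
    open ≤-Reasoning
    x₀ : Fin (suc a + sum α)
    x₀ = Fin.zero ↑ˡ sum α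

  proper-forced : ∀ α → All (0 <_) α → (κ : Fin (sum α) → ℕ) → IsProper (ordinalSum F α) κ →
                  ∀ d → (∀ x → d ≤ κ x) → (∀ x → κ x < d + length α) → ∀ x → κ x ≡ blockColouring α d x
  proper-forced (zero ∷ α)  (() ∷ _)
  proper-forced (suc a ∷ α) (_ ∷ α>0) κ proper d κ≥d κ<d+ x with joinView (suc a) (sum α) x
  ... | left i  = trans (≤-antisym κi≤d (κ≥d _)) (sym (blockColouring-ˡ (suc a) α d i))
    where
    κi+ : suc (κ (i ↑ˡ sum α)) + length α ≤ suc d + length α
    κi+ = subst (suc (κ (i ↑ˡ sum α)) + length α ≤_) (+-suc d (length α))
            (colour-range α α>0 (κ ∘ (suc a ↑ʳ_)) (join-proper-ʳ _ _ proper)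
              (κ<d+ _) (join-proper-< _ _ proper i) (κ<d+ ∘ (suc a ↑ʳ_)))
    κi≤d : κ (i ↑ˡ sum α) ≤ d
    κi≤d = ≤-pred (+-cancelʳ-≤ (length α) _ _ κi+)
  ... | right j = trans (proper-forced α α>0 (κ ∘ (suc a ↑ʳ_)) (join-proper-ʳ _ _ proper) (suc d) κʳ≥ κʳ< j)
                        (sym (blockColouring-ʳ (suc a) α d j))
    where
    κʳ≥ : ∀ j → suc d ≤ κ (suc a ↑ʳ j)
    κʳ≥ j = ≤-trans (s≤s (κ≥d _)) (join-proper-< _ _ proper Fin.zero j)
    κʳ< : ∀ j → κ (suc a ↑ʳ j) < suc d + length α
    κʳ< j = subst (κ (suc a ↑ʳ j) <_) (+-suc d (length α)) (κ<d+ (suc a ↑ʳ j))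

  module _ (α : List ℕ) (α>0 : All (0 <_) α) where

    few-colours-forced : ∀ {m} (κ : Vec (Fin m) (sum α)) → IsProper (ordinalSum F α) (colouringOf κ) →
                         m ≤ length α → m ≡ length α × (∀ x → colouringOf κ x ≡ blockColouring α 0 x)
    few-colours-forced {m} κ proper m≤|α| = m≡|α| ,
      proper-forced α α>0 (colouringOf κ) proper 0 (λ _ → z≤n) (λ x → subst (colouringOf κ x <_) m≡|α| (κ<m x))
      where
      κ<m : ∀ x → colouringOf κ x < m
      κ<m x = Finₚ.toℕ<n (Vec.lookup κ x)
      m≡|α| : m ≡ length α
      m≡|α| = ≤-antisym m≤|α| (colour-range α α>0 (colouringOf κ) proper z≤n (λ _ → z≤n) κ<m)

    few-colours-content : ∀ {m e} (κ : Vec (Fin m) (sum α)) → ProperWithContent (ordinalSum F α) m e κ →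
                          m ≤ length α → e ≡ α
    few-colours-content {m} κ (proper , hasContent) m≤|α| with few-colours-forced κ proper m≤|α|
    ... | refl , forced = trans (sym hasContent) (trans (content-≗ m forced) (content-blockColouring α))

    chromCoeff-ordinalSum-≢ : ∀ e → length e ≤ length α → e ≢ α → chromCoeff (ordinalSum F α) e ≡ 0
    chromCoeff-ordinalSum-≢ e |e|≤|α| e≢α =
      colourings-empty (ordinalSum F α) (length e) e (λ κ valid → e≢α (few-colours-content κ valid |e|≤|α|))

    chromCoeff-ordinalSum-≡ : (∀ i → 0 < i → AllEdgesDouble (F i)) → chromCoeff (ordinalSum F α) α ≡ 1
    chromCoeff-ordinalSum-≡ F-double =
      unique⇒length-≡ (colourings-unique (ordinalSum F α) (length α) α) ([] ∷ []) (mk⇔ to from)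
      where
      w₀ : Vec (Fin (length α)) (sum α)
      w₀ = Vec.tabulate (λ x → fromℕ< (blockColouring-< α 0 x))
      colouringOf-w₀ : ∀ x → colouringOf w₀ x ≡ blockColouring α 0 x
      colouringOf-w₀ x = trans (cong toℕ (Vecₚ.lookup∘tabulate _ x)) (Finₚ.toℕ-fromℕ< _)
      w₀-valid : ProperWithContent (ordinalSum F α) (length α) α w₀
      w₀-valid = IsProper-≗ (ordinalSum F α) (sym ∘ colouringOf-w₀) (blockColouring-proper F F-double α α>0 0) ,
                 trans (content-≗ (length α) colouringOf-w₀) (content-blockColouring α)
      to : ∀ {κ} → κ ∈ colourings (ordinalSum F α) (length α) α → κ ∈ [ w₀ ]
      to {κ} κ∈ = here (lookup-ext λ x → Finₚ.toℕ-injective (trans (forced x) (sym (colouringOf-w₀ x))))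
        where
        forced : ∀ x → colouringOf κ x ≡ blockColouring α 0 x
        forced = proj₂ (few-colours-forced κ (proj₁ (∈-colourings⁻ (ordinalSum F α) (length α) α κ∈)) ≤-refl)
      from : ∀ {κ} → κ ∈ [ w₀ ] → κ ∈ colourings (ordinalSum F α) (length α) α
      from (here refl) = ∈-colourings⁺ (ordinalSum F α) (length α) α w₀-valid

-- Unitriangular families of series

module _ {I : Set} (b : I → Series) where

  linComb-vanishes : ∀ L e → (∀ i → b i e ≡ 0ℚ) → linComb b L e ≡ 0ℚ
  linComb-vanishes []            e b≡0 = refl
  linComb-vanishes ((i , c) ∷ L) e b≡0 = begin
    c *ℚ b i e +ℚ linComb b L e  ≡⟨ cong₂ (λ x y → c *ℚ x +ℚ y) (b≡0 i) (linComb-vanishes L e b≡0) ⟩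
    c *ℚ 0ℚ +ℚ 0ℚ                ≡⟨ cong (_+ℚ 0ℚ) (ℚₚ.*-zeroʳ c) ⟩
    0ℚ                           ∎
    where open ≡-Reasoning

  linComb-cong : ∀ L e e′ → (∀ i → b i e ≡ b i e′) → linComb b L e ≡ linComb b L e′
  linComb-cong []            e e′ b≡ = refl
  linComb-cong ((i , c) ∷ L) e e′ b≡ = cong₂ (λ x y → c *ℚ x +ℚ y) (b≡ i) (linComb-cong L e e′ b≡)

  linComb-isQSym : ∀ {n} → (∀ i → IsQSym n (b i)) → ∀ L → IsQSym n (linComb b L)
  linComb-isQSym qsym L = isQSym (linComb b L)
    (λ e sum≢n → linComb-vanishes L e (λ i → IsQSym-vanishes (qsym i) e sum≢n))
    (λ e e′ eq → linComb-cong L e e′ (λ i → proj₂ (qsym i) e e′ eq))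

module Unitriangular {I : Set} (b : I → Series) (rank : I → ℕ) (point : I → List ℕ)
  (b-diagonal : ∀ i → b i (point i) ≡ 1ℚ)
  (b-offDiagonal : ∀ i j → rank j ≤ rank i → j ≢ i → b i (point j) ≡ 0ℚ) where

  private
    term-vanishes : ∀ {j} i c → i ≢ j → (rank i < rank j → c ≡ 0ℚ) → c *ℚ b i (point j) ≡ 0ℚ
    term-vanishes {j} i c i≢j low with rank i <? rank j
    ... | yes i<j = trans (cong (_*ℚ b i (point j)) (low i<j)) (ℚₚ.*-zeroˡ (b i (point j)))
    ... | no  i≮j = trans (cong (c *ℚ_) (b-offDiagonal i j (≮⇒≥ i≮j) (i≢j ∘ sym))) (ℚₚ.*-zeroʳ c)

  linComb-at-point : ∀ {j c} L → Unique (map proj₁ L) → (j , c) ∈ L →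
                     (∀ {i d} → (i , d) ∈ L → rank i < rank j → d ≡ 0ℚ) → linComb b L (point j) ≡ c
  linComb-at-point {j} {c} ((j , c) ∷ L) (j∉L ∷ _) (here refl) low = begin
    c *ℚ b j (point j) +ℚ linComb b L (point j)
      ≡⟨ cong₂ _+ℚ_ (cong (c *ℚ_) (b-diagonal j)) (others L j∉L (low ∘ there)) ⟩
    c *ℚ 1ℚ +ℚ 0ℚ                                ≡⟨ ℚₚ.+-identityʳ _ ⟩
    c *ℚ 1ℚ                                      ≡⟨ ℚₚ.*-identityʳ c ⟩
    c                                            ∎
    where
    open ≡-Reasoning
    others : ∀ L → All (j ≢_) (map proj₁ L) → (∀ {i d} → (i , d) ∈ L → rank i < rank j → d ≡ 0ℚ) →
             linComb b L (point j) ≡ 0ℚ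
    others []            _            _   = refl
    others ((i , d) ∷ L) (j≢i ∷ j∉L) low′ =
      trans (cong₂ _+ℚ_ (term-vanishes i d (j≢i ∘ sym) (low′ (here refl))) (others L j∉L (low′ ∘ there)))
            (ℚₚ.+-identityʳ 0ℚ)
  linComb-at-point ((i , d) ∷ L) (j∉L ∷ L!) (there jc∈L) low =
    trans (cong₂ _+ℚ_ (term-vanishes i d (λ { refl → All.lookup j∉L (∈-map⁺ proj₁ jc∈L) refl })
                                          (low (here refl)))
                      (linComb-at-point L L! jc∈L (low ∘ there)))
          (ℚₚ.+-identityˡ _)

  -- By induction on the rank: at the point of an index of rank r only its own coefficient survives.
  linearlyIndependent : LinearlyIndependent b
  linearlyIndependent L L! L≡0 = All.tabulate (λ {(i , c)} ic∈L → vanishes (rank i) ic∈L refl)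
    where
    vanishes : ∀ r {i c} → (i , c) ∈ L → rank i ≡ r → c ≡ 0ℚ
    vanishes = <-rec _ λ { r IH {i} ic∈L refl →
      trans (sym (linComb-at-point L L! ic∈L (λ jd∈L j<i → IH j<i jd∈L refl))) (L≡0 (point i)) }

  module Interpolation (_≟ᵢ_ : DecidableEquality I) (indices : List I) (∈-indices : ∀ i → i ∈ indices)
                       (bound : ℕ) (rank<bound : ∀ i → rank i < bound) (g : I → ℚ) where

    Interpolable : (I → Set) → Set
    Interpolable S = ∃ λ L → ∀ i → S i → linComb b L (point i) ≡ g i

    interpolable-⊆ : ∀ {S T : I → Set} → (∀ i → T i → S i) → Interpolable S → Interpolable T
    interpolable-⊆ T⊆S (L , ok) = L , λ i → ok i ∘ T⊆S i

    interpolable-add : ∀ {S} β → (∀ i → S i → rank i ≤ rank β) →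
                       Interpolable S → Interpolable (λ i → S i ⊎ i ≡ β)
    interpolable-add {S} β S≤β (L , ok) = (β , c) ∷ L , fits
      where
      open ≡-Reasoning
      open +-*-Solver
      l : I → ℚ
      l i = linComb b L (point i)
      c : ℚ
      c = g β - l β
      fits : ∀ i → S i ⊎ i ≡ β → c *ℚ b β (point i) +ℚ l i ≡ g i
      fits i S⊎β with i ≟ᵢ β | S⊎β
      ... | yes refl | _       = begin
        c *ℚ b i (point i) +ℚ l i  ≡⟨ cong (λ x → c *ℚ x +ℚ l i) (b-diagonal i) ⟩
        c *ℚ 1ℚ +ℚ l i             ≡⟨ cong (_+ℚ l i) (ℚₚ.*-identityʳ c) ⟩
        (g i - l i) +ℚ l i         ≡⟨ solve 2 (λ x y → (x :- y) :+ y := x) refl (g i) (l i) ⟩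
        g i                        ∎
      ... | no i≢β  | inj₂ i≡β = ⊥-elim (i≢β i≡β)
      ... | no i≢β  | inj₁ Si  = begin
        c *ℚ b β (point i) +ℚ l i  ≡⟨ cong (λ x → c *ℚ x +ℚ l i) (b-offDiagonal β i (S≤β i Si) i≢β) ⟩
        c *ℚ 0ℚ +ℚ l i             ≡⟨ cong (_+ℚ l i) (ℚₚ.*-zeroʳ c) ⟩
        0ℚ +ℚ l i                  ≡⟨ ℚₚ.+-identityˡ (l i) ⟩
        l i                        ≡⟨ ok i Si ⟩
        g i                        ∎

    interpolable-layer : ∀ {S} r js → (∀ i → S i → rank i ≤ r) → All (λ j → rank j ≡ r) js →
                         Interpolable S → Interpolable (λ i → S i ⊎ i ∈ js)
    interpolable-layer r []       S≤r []             = interpolable-⊆ λ i → [ (λ Si → Si) , (λ ()) ]′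
    interpolable-layer {S} r (j ∷ js) S≤r (j≡r ∷ js≡r) ok =
      interpolable-⊆ (λ i → [ inj₁ ∘ inj₁ , (λ { (here i≡j) → inj₂ i≡j ; (there i∈js) → inj₁ (inj₂ i∈js) }) ]′)
        (interpolable-add j below-j (interpolable-layer r js S≤r js≡r ok))
      where
      below-j : ∀ i → S i ⊎ i ∈ js → rank i ≤ rank j
      below-j i (inj₁ Si)   = subst (rank i ≤_) (sym j≡r) (S≤r i Si)
      below-j i (inj₂ i∈js) = ≤-reflexive (trans (All.lookup js≡r i∈js) (sym j≡r))

    interpolable-below : ∀ r → Interpolable (λ i → rank i < r)
    interpolable-below zero    = [] , λ i ()
    interpolable-below (suc r) =
      interpolable-⊆ split
        (interpolable-layer r layer (λ i → <⇒≤) (all-filter (λ i → rank i ≟ r) indices) (interpolable-below r))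
      where
      layer : List I
      layer = filter (λ i → rank i ≟ r) indices
      split : ∀ i → rank i < suc r → rank i < r ⊎ i ∈ layer
      split i (s≤s i≤r) = [ inj₁ , inj₂ ∘ ∈-filter⁺ (λ i → rank i ≟ r) (∈-indices i) ]′ (m≤n⇒m<n∨m≡n i≤r)

    interpolate : ∃ λ L → ∀ i → linComb b L (point i) ≡ g i
    interpolate with L , ok ← interpolable-below bound = L , λ i → ok i (rank<bound i)

Composition-≡ : ∀ {n} (α β : Composition n) → proj₁ α ≡ proj₁ β → α ≡ β
Composition-≡ (α , α>0 , Σα≡n) (α , α>0′ , Σα≡n′) refl =
  cong₂ (λ p q → α , p , q) (All.irrelevant ≤-irrelevant α>0 α>0′) (ℕ-≡-irrelevant Σα≡n Σα≡n′)

_≟-composition_ : ∀ {n} → DecidableEquality (Composition n)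
α ≟-composition β = map′ (Composition-≡ α β) (cong proj₁) (≡-dec _≟_ (proj₁ α) (proj₁ β))

isComposition? : ∀ n e → Dec (IsComposition n e)
isComposition? n e = All.all? (0 <?_) e ×-dec (sum e ≟ n)

length≤sum : ∀ α → All (0 <_) α → length α ≤ sum α
length≤sum []      []          = z≤n
length≤sum (a ∷ α) (a>0 ∷ α>0) = +-mono-≤ a>0 (length≤sum α α>0)

parts≤sum : ∀ α → All (_≤ sum α) α
parts≤sum []      = []
parts≤sum (a ∷ α) = m≤m+n a (sum α) ∷ All.map (λ x≤Σα → ≤-trans x≤Σα (m≤n+m (sum α) a)) (parts≤sum α)

shortLists : ℕ → ℕ → List (List ℕ)
shortLists zero    N = [ [] ]
shortLists (suc ℓ) N = [] ∷ cartesianProductWith _∷_ (upTo N) (shortLists ℓ N)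

∈-shortLists : ∀ ℓ N e → length e ≤ ℓ → All (_< N) e → e ∈ shortLists ℓ N
∈-shortLists zero    N []      _           _           = here refl
∈-shortLists (suc ℓ) N []      _           _           = here refl
∈-shortLists (suc ℓ) N (x ∷ e) (s≤s |e|≤ℓ) (x<N ∷ e<N) =
  there (∈-cartesianProductWith⁺ _∷_ (∈-upTo⁺ x<N) (∈-shortLists ℓ N e |e|≤ℓ e<N))

compositionsIn : ∀ n → List (List ℕ) → List (Composition n)
compositionsIn n []       = []
compositionsIn n (e ∷ es) with isComposition? n e
... | yes isComp = (e , isComp) ∷ compositionsIn n es
... | no  _      = compositionsIn n es

∈-compositionsIn : ∀ {n} (α : Composition n) es → proj₁ α ∈ es → α ∈ compositionsIn n es
∈-compositionsIn {n} α (e ∷ es) α∈ with isComposition? n e | α∈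
... | yes isComp | here refl = here (Composition-≡ α (e , isComp) refl)
... | yes _      | there α∈es = there (∈-compositionsIn α es α∈es)
... | no ¬isComp | here refl = ⊥-elim (¬isComp (proj₂ α))
... | no _       | there α∈es = ∈-compositionsIn α es α∈es

allCompositions : ∀ n → List (Composition n)
allCompositions n = compositionsIn n (shortLists n (suc n))

length≤n : ∀ {n} (α : Composition n) → length (proj₁ α) ≤ n
length≤n (α , α>0 , Σα≡n) = subst (length α ≤_) Σα≡n (length≤sum α α>0)

∈-allCompositions : ∀ {n} (α : Composition n) → α ∈ allCompositions n
∈-allCompositions {n} α@(parts , _ , Σparts≡n) = ∈-compositionsIn α (shortLists n (suc n))
  (∈-shortLists n (suc n) parts (length≤n α)
    (All.map (λ x≤Σ → s≤s (subst (_ ≤_) Σparts≡n x≤Σ)) (parts≤sum parts)))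

removeZeros-positive : ∀ e → All (0 <_) (removeZeros e)
removeZeros-positive []          = []
removeZeros-positive (zero ∷ e)  = removeZeros-positive e
removeZeros-positive (suc x ∷ e) = s≤s z≤n ∷ removeZeros-positive e

sum-removeZeros : ∀ e → sum (removeZeros e) ≡ sum e
sum-removeZeros []          = refl
sum-removeZeros (zero ∷ e)  = sum-removeZeros e
sum-removeZeros (suc x ∷ e) = cong (suc x +_) (sum-removeZeros e)

removeZeros-idempotent : ∀ e → removeZeros (removeZeros e) ≡ removeZeros e
removeZeros-idempotent []          = refl
removeZeros-idempotent (zero ∷ e)  = removeZeros-idempotent e
removeZeros-idempotent (suc x ∷ e) = cong (suc x ∷_) (removeZeros-idempotent e)

IsQSym-determined : ∀ {n f g} → IsQSym n f → IsQSym n g →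
                    (∀ (α : Composition n) → f (proj₁ α) ≡ g (proj₁ α)) → ∀ e → f e ≡ g e
IsQSym-determined {n} {f} {g} qf qg agree e with sum e ≟ n
... | no  sum≢n = trans (IsQSym-vanishes qf e sum≢n) (sym (IsQSym-vanishes qg e sum≢n))
... | yes sum≡n = begin
  f e                ≡⟨ proj₂ qf e (removeZeros e) (sym (removeZeros-idempotent e)) ⟩
  f (removeZeros e)  ≡⟨ agree (removeZeros e , removeZeros-positive e , trans (sum-removeZeros e) sum≡n) ⟩
  g (removeZeros e)  ≡⟨ proj₂ qg (removeZeros e) e (removeZeros-idempotent e) ⟩
  g e                ∎
  where open ≡-Reasoning

mainTheorem11 : (F : (i : ℕ) → Digraph i) →
                (∀ i → 0 < i → AllEdgesDouble (F i)) →
                (n : ℕ) →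
                IsBasisOfQSym n (λ (α : Composition n) → 𝒳 (ordinalSum F (proj₁ α)))
mainTheorem11 F F-double n = 𝒳F-isQSym , linearlyIndependent , spans
  where
  𝒳F : Composition n → Series
  𝒳F α = 𝒳 (ordinalSum F (proj₁ α))

  𝒳F-isQSym : ∀ α → IsQSym n (𝒳F α)
  𝒳F-isQSym (α , _ , Σα≡n) = subst (λ k → IsQSym k (𝒳 (ordinalSum F α))) Σα≡n (𝒳-isQSym (ordinalSum F α))

  diagonal : ∀ α → 𝒳F α (proj₁ α) ≡ 1ℚ
  diagonal (α , α>0 , _) = 𝒳-≡ (ordinalSum F α) α (chromCoeff-ordinalSum-≡ F α α>0 F-double)

  offDiagonal : ∀ α β → length (proj₁ β) ≤ length (proj₁ α) → β ≢ α → 𝒳F α (proj₁ β) ≡ 0ℚ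
  offDiagonal α′@(α , α>0 , _) β |β|≤|α| β≢α = 𝒳-≡ (ordinalSum F α) (proj₁ β)
    (chromCoeff-ordinalSum-≢ F α α>0 (proj₁ β) |β|≤|α| (β≢α ∘ Composition-≡ β α′))

  open Unitriangular 𝒳F (length ∘ proj₁) proj₁ diagonal offDiagonal

  spans : ∀ f → IsQSym n f → ∃ λ L → ∀ e → linComb 𝒳F L e ≡ f e
  spans f qf =
    let L , agree = Interpolation.interpolate _≟-composition_ (allCompositions n) ∈-allCompositions
                                              (suc n) (s≤s ∘ length≤n) (f ∘ proj₁)
    in L , IsQSym-determined (linComb-isQSym 𝒳F 𝒳F-isQSym L) qf agree
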